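{- Let $k \geq 2$, let $\rho \in \mathcal{P}_k$, and let $m := \mathbf{mdd}(\rho)$. If $\rho_i = 0$ for some $i \geq 2$, then there exists a $\rho$-minimal inversion sequence of length $k + 2m$.
   Context: An inversion sequence of length $n$ is an integer sequence $\sigma=(\sigma_1,\dots,\sigma_n)$ with $\sigma_i\in\{0,\dots,i-1\}$ for all $i$; $\mathcal I$ is the set of all inversion sequences. A Cayley permutation of length $k$ is an integer sequence of length $k$ whose set of values is exactly $\{0,\dots,m\}$ for its maximum $m$; $\mathcal P_k$ is the set of these and $\mathcal P$ the set of all of them. For integer sequences $\sigma$ and $\rho$, $\sigma$ contains $\rho$ (written $\rho\preceq\sigma$) if some subsequence of $|\rho|$ entries of $\sigma$ has its values in the same relative order as $\rho$. $\mathbf{mdd}(\sigma)=\max_{i}(\sigma_i-i+1)$ (positions indexed from 1). For a nonempty Cayley permutation $\rho$, let $\mathcal{IP}[\rho]=\{\sigma\in\mathcal I\cap\mathcal P : \rho\preceq\sigma\}$; $\sigma$ is a $\rho$-minimal inversion sequence if it is a minimal element of the poset $(\mathcal{IP}[\rho],\preceq)$. -}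

module Defs where

open import Data.Nat using (ℕ; zero; suc; _≤_; _<_)
open import Data.Nat.Properties using (<-cmp)
open import Data.Integer as ℤ using (ℤ; +_; _-_; _⊔_)
open import Data.List using (List; []; _∷_; length; lookup)
open import Data.List.Relation.Binary.Sublist.Propositional using (_⊆_)
open import Data.List.Membership.Propositional using (_∈_)
open import Data.Fin using (Fin; toℕ)
open import Data.Product using (Σ; ∃; _×_; _,_)
open import Relation.Binary.PropositionalEquality using (_≡_)
open import Relation.Binary.Definitions using (Tri; tri<; tri≈; tri>)
open import Relation.Nullary using (¬_)

-- Sequences are lists of naturals; positions are indexed from 1 in the paper,
-- from 0 (Fin) in Agda.

IsInversionSequence : List ℕ → Set
IsInversionSequence σ = (i : Fin (length σ)) → lookup σ i ≤ toℕ i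

-- Cayley permutation: the set of values is exactly {0,…,max}, i.e.
-- every value v below some entry occurs as an entry.
IsCayley : List ℕ → Set
IsCayley σ = ∀ (v w : ℕ) → w ∈ σ → v ≤ w → v ∈ σ

data Ord3 : Set where lt eq gt : Ord3

cmp : ℕ → ℕ → Ord3
cmp a b with <-cmp a b
... | tri< _ _ _ = lt
... | tri≈ _ _ _ = eq
... | tri> _ _ _ = gt

SameOrder : List ℕ → List ℕ → Set
SameOrder α β = Σ (length α ≡ length β) λ e →
  (i j : Fin (length α)) →
    cmp (lookup α i) (lookup α j) ≡ cmp (lookup β (Data.Fin.cast e i)) (lookup β (Data.Fin.cast e j))

_⪯_ : List ℕ → List ℕ → Set
ρ ⪯ σ = ∃ λ τ → (τ ⊆ σ) × SameOrder ρ τ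

-- mdd(σ) = max_i (σ_i - i + 1), positions from 1; i.e. max over 0-indexed j of σ_j - j.
-- For the empty sequence we return 0 (irrelevant here: only used on nonempty ρ).
mddFrom : ℕ → List ℕ → ℤ
mddFrom j [] = + 0
mddFrom j (x ∷ []) = + x - + j
mddFrom j (x ∷ y ∷ xs) = (+ x - + j) ⊔ mddFrom (suc j) (y ∷ xs)

mdd : List ℕ → ℤ
mdd = mddFrom 0

InIP : List ℕ → List ℕ → Set
InIP ρ σ = IsInversionSequence σ × IsCayley σ × (ρ ⪯ σ)

IsMinimal : List ℕ → List ℕ → Set
IsMinimal ρ σ = InIP ρ σ × (∀ τ → InIP ρ τ → τ ⪯ σ → τ ≡ σ)

-- Both minimal sequences have the form σ = P ++ (ρ′ + m), where P has length 2B and lists every value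
-- below B exactly twice, and ρ′ is ρ without its first s entries.  If ρ has a zero at a position i ≥ 1
-- other than a second leading zero (or m = 0), take B = m, P = 0 0 1 1 … (m-1) (m-1) and ρ′ = ρ;
-- otherwise ρ = 0 0 ρ₂ with ρ₂ positive, and take B = m + 1, P = 0 1 … m m … 1 0 and ρ′ = ρ₂, the two
-- leading zeros going to both ends of P.  Since m = mdd ρ, σ is an inversion sequence whose entry at some
-- tail position 2B + e (counting from 0) is 2B + e, and the zeros of ρ force every occurrence of ρ in σ
-- to put ρ′ onto the tail of σ.
--
-- For minimality let ρ ⪯ τ ⪯ σ with τ ∈ IP[ρ], where A entries of τ land in P, taking d distinct values.
-- These d values and the values B, …, 2B+e-1 of the tail (present since σ is Cayley) give an increasing
-- chain of d + B + e entries of τ below the entry landing on position 2B + e, which sits at position A + e;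
-- as τ is an inversion sequence, d + B ≤ A.  Each value occurs at most twice in P, so A ≤ 2d.  Hence
-- A = 2B: τ fills all of σ, so it has the pattern of σ, and Cayley permutations with one pattern coincide.

module Submission where

open import Defs
open import Data.Nat using (ℕ; zero; suc; _+_; _*_; _∸_; _≤_; _<_; _>_; z≤n; s≤s; _≟_; _<?_; ⌊_/2⌋)
open import Data.Nat.Properties
open import Data.Nat.Tactic.RingSolver using (solve-∀)
import Data.Integer as ℤ
import Data.Integer.Properties as ℤ
import Data.Integer.Tactic.RingSolver as ℤ-Solver
open import Data.List using (List; []; _∷_; length; lookup; map; _++_; applyUpTo)
open import Data.List.Properties using (length-map; length-++; length-applyUpTo)
open import Data.List.Membership.Propositional using (_∈_)
open import Data.List.Membership.Propositional.Properties using (∈-applyUpTo⁺)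
open import Data.List.Membership.DecPropositional _≟_ using (_∈?_)
open import Data.List.Relation.Unary.Any using (here; there)
open import Data.List.Relation.Unary.All as All using (All; []; _∷_)
import Data.List.Relation.Unary.All.Properties as All
open import Data.List.Relation.Unary.AllPairs using (AllPairs; []; _∷_)
import Data.List.Relation.Unary.AllPairs.Properties as AllPairs
open import Data.List.Relation.Binary.Sublist.Propositional using (_⊆_; []; _∷_; _∷ʳ_; ⊆-refl)
open import Data.List.Relation.Binary.Sublist.Propositional.Properties using (++⁺ˡ)
open import Data.Fin using (Fin; toℕ; fromℕ<; cast)
open import Data.Fin.Properties using (toℕ<n; toℕ-cast; toℕ-fromℕ<)
open import Data.Product using (∃; _×_; _,_; proj₁; proj₂)
open import Data.Sum using (_⊎_; inj₁; inj₂; [_,_]′)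
open import Data.Empty using (⊥; ⊥-elim)
open import Function using (_∘_; _on_)
open import Relation.Nullary using (¬_; Dec; yes; no)
open import Relation.Unary using (Decidable)
open import Relation.Binary.Definitions using (tri<; tri≈; tri>)
open import Relation.Binary.PropositionalEquality
  using (_≡_; _≢_; refl; sym; trans; cong; cong₂; subst; subst₂; module ≡-Reasoning)

-- `at σ p` is σ_{p+1} in the paper's notation; it is 0 outside the sequence.
at : List ℕ → ℕ → ℕ
at []       _       = 0
at (x ∷ xs) zero    = x
at (x ∷ xs) (suc p) = at xs p

lookup≡at : ∀ xs (i : Fin (length xs)) → lookup xs i ≡ at xs (toℕ i)
lookup≡at (x ∷ xs) Fin.zero    = refl
lookup≡at (x ∷ xs) (Fin.suc i) = lookup≡at xs i

at-∈ : ∀ {xs p} → p < length xs → at xs p ∈ xs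
at-∈ {x ∷ xs} {zero}  _         = here refl
at-∈ {x ∷ xs} {suc p} (s≤s p<) = there (at-∈ p<)

∈⇒at : ∀ {xs w} → w ∈ xs → ∃ λ p → p < length xs × at xs p ≡ w
∈⇒at (here refl) = 0 , s≤s z≤n , refl
∈⇒at (there w∈) with p , p< , atp ← ∈⇒at w∈ = suc p , s≤s p< , atp

at-map : ∀ (f : ℕ → ℕ) {xs p} → p < length xs → at (map f xs) p ≡ f (at xs p)
at-map f {x ∷ xs} {zero}  _         = refl
at-map f {x ∷ xs} {suc p} (s≤s p<) = at-map f {xs} p<

at-++ˡ : ∀ {xs} ys {p} → p < length xs → at (xs ++ ys) p ≡ at xs p
at-++ˡ {x ∷ xs} ys {zero}  _         = refl
at-++ˡ {x ∷ xs} ys {suc p} (s≤s p<) = at-++ˡ {xs} ys p<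

at-++ʳ : ∀ xs {ys} p → at (xs ++ ys) (length xs + p) ≡ at ys p
at-++ʳ []       p = refl
at-++ʳ (x ∷ xs) p = at-++ʳ xs p

at-applyUpTo : ∀ (f : ℕ → ℕ) {n p} → p < n → at (applyUpTo f n) p ≡ f p
at-applyUpTo f {suc n} {zero}  _         = refl
at-applyUpTo f {suc n} {suc p} (s≤s p<) = at-applyUpTo (λ q → f (suc q)) p<

at-ext : ∀ {xs ys} → length xs ≡ length ys → (∀ {p} → p < length xs → at xs p ≡ at ys p) → xs ≡ ys
at-ext {[]}     {[]}     _  _   = refl
at-ext {x ∷ xs} {y ∷ ys} len ext = cong₂ _∷_ (ext (s≤s z≤n)) (at-ext (suc-injective len) (λ p< → ext (s≤s p<)))

<⇒cmp≡lt : ∀ {a b} → a < b → cmp a b ≡ lt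
<⇒cmp≡lt {a} {b} a<b with <-cmp a b
... | tri< _ _ _  = refl
... | tri≈ a≮b _ _ = ⊥-elim (a≮b a<b)
... | tri> a≮b _ _ = ⊥-elim (a≮b a<b)

≡⇒cmp≡eq : ∀ {a b} → a ≡ b → cmp a b ≡ eq
≡⇒cmp≡eq {a} {b} a≡b with <-cmp a b
... | tri< _ a≢b _ = ⊥-elim (a≢b a≡b)
... | tri≈ _ _ _   = refl
... | tri> _ a≢b _ = ⊥-elim (a≢b a≡b)

>⇒cmp≡gt : ∀ {a b} → b < a → cmp a b ≡ gt
>⇒cmp≡gt {a} {b} b<a with <-cmp a b
... | tri< _ _ b≮a = ⊥-elim (b≮a b<a)
... | tri≈ _ _ b≮a = ⊥-elim (b≮a b<a)
... | tri> _ _ _   = refl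

cmp≡lt⇒< : ∀ {a b} → cmp a b ≡ lt → a < b
cmp≡lt⇒< {a} {b} c with <-cmp a b
cmp≡lt⇒< {a} {b} refl | tri< a<b _ _ = a<b

cmp≡eq⇒≡ : ∀ {a b} → cmp a b ≡ eq → a ≡ b
cmp≡eq⇒≡ {a} {b} c with <-cmp a b
cmp≡eq⇒≡ {a} {b} refl | tri≈ _ a≡b _ = a≡b

cmp-preserved : ∀ {F : ℕ → ℕ} → (∀ {x y} → x < y → F x < F y) → ∀ x y → cmp (F x) (F y) ≡ cmp x y
cmp-preserved {F} F-mono x y with <-cmp x y
... | tri< x<y _ _ = <⇒cmp≡lt (F-mono x<y)
... | tri≈ _ refl _ = ≡⇒cmp≡eq refl
... | tri> _ _ y<x = >⇒cmp≡gt (F-mono y<x)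

IsInversionAt : List ℕ → Set
IsInversionAt σ = ∀ {p} → p < length σ → at σ p ≤ p

IsCayleyAt : List ℕ → Set
IsCayleyAt σ = ∀ {v p} → p < length σ → v ≤ at σ p → ∃ λ p′ → p′ < length σ × at σ p′ ≡ v

SameOrderAt : ℕ → List ℕ → List ℕ → Set
SameOrderAt n α β = ∀ {a b} → a < n → b < n → cmp (at α a) (at α b) ≡ cmp (at β a) (at β b)

inversion-toAt : ∀ {σ} → IsInversionSequence σ → IsInversionAt σ
inversion-toAt {σ} inv {p} p< =
  subst₂ _≤_ (trans (lookup≡at σ i) (cong (at σ) (toℕ-fromℕ< p<))) (toℕ-fromℕ< p<) (inv i)
  where i = fromℕ< p<

inversion-fromAt : ∀ {σ} → IsInversionAt σ → IsInversionSequence σ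
inversion-fromAt {σ} inv i = subst (_≤ toℕ i) (sym (lookup≡at σ i)) (inv (toℕ<n i))

cayley-toAt : ∀ {σ} → IsCayley σ → IsCayleyAt σ
cayley-toAt {σ} cay {v} p< v≤ = ∈⇒at (cay v _ (at-∈ p<) v≤)

cayley-fromAt : ∀ {σ} → IsCayleyAt σ → IsCayley σ
cayley-fromAt cay v w w∈ v≤w with p , p< , refl ← ∈⇒at w∈ with p′ , p′< , refl ← cay p< v≤w = at-∈ p′<

at≡lookup : ∀ xs {c} (i : Fin (length xs)) → toℕ i ≡ c → at xs c ≡ lookup xs i
at≡lookup xs i refl = sym (lookup≡at xs i)

sameOrder-toAt : ∀ {α β} → SameOrder α β → length α ≡ length β × SameOrderAt (length α) α β
sameOrder-toAt {α} {β} (len , same) = len , λ {a} {b} a< b< →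
  let i = fromℕ< a< ; j = fromℕ< b< in
  begin
    cmp (at α a) (at α b)
  ≡⟨ cong₂ cmp (at≡lookup α i (toℕ-fromℕ< a<)) (at≡lookup α j (toℕ-fromℕ< b<)) ⟩
    cmp (lookup α i) (lookup α j)
  ≡⟨ same i j ⟩
    cmp (lookup β (cast len i)) (lookup β (cast len j))
  ≡⟨ cong₂ cmp (at≡lookup β (cast len i) (trans (toℕ-cast len i) (toℕ-fromℕ< a<)))
               (at≡lookup β (cast len j) (trans (toℕ-cast len j) (toℕ-fromℕ< b<))) ⟨
    cmp (at β a) (at β b)
  ∎
  where open ≡-Reasoning

sameOrder-fromAt : ∀ {α β} → length α ≡ length β → SameOrderAt (length α) α β → SameOrder α β
sameOrder-fromAt {α} {β} len same = len , λ i j →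
  begin
    cmp (lookup α i) (lookup α j)
  ≡⟨ cong₂ cmp (at≡lookup α i refl) (at≡lookup α j refl) ⟨
    cmp (at α (toℕ i)) (at α (toℕ j))
  ≡⟨ same (toℕ<n i) (toℕ<n j) ⟩
    cmp (at β (toℕ i)) (at β (toℕ j))
  ≡⟨ cong₂ cmp (at≡lookup β (cast len i) (toℕ-cast len i)) (at≡lookup β (cast len j) (toℕ-cast len j)) ⟩
    cmp (lookup β (cast len i)) (lookup β (cast len j))
  ∎
  where open ≡-Reasoning

sameOrder-image : ∀ {α β} {F : ℕ → ℕ} → (∀ {x y} → x < y → F x < F y) → length α ≡ length β →
                  (∀ {a} → a < length α → at β a ≡ F (at α a)) → SameOrder α β
sameOrder-image {α} {β} {F} F-increasing len image = sameOrder-fromAt {α} {β} len λ {a} {b} a< b< →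
  sym (trans (cong₂ cmp (image a<) (image b<)) (cmp-preserved F-increasing (at α a) (at α b)))

split-position : ∀ {a b p} → p < a + b → p < a ⊎ ∃ λ t → t < b × p ≡ a + t
split-position {a} {b} {p} p< with p <? a
... | yes p<a = inj₁ p<a
... | no p≮a = inj₂ (p ∸ a , +-cancelˡ-< a _ _ (subst (_< a + b) p≡a+t p<) , p≡a+t)
  where
  p≡a+t : p ≡ a + (p ∸ a)
  p≡a+t = sym (m+[n∸m]≡n (≮⇒≥ p≮a))

StrictlyIncreasing : ℕ → (ℕ → ℕ) → Set
StrictlyIncreasing n f = ∀ {a b} → a < b → b < n → f a < f b

increasing-gap : ∀ {n f} → StrictlyIncreasing n f → ∀ {a} d → a + d < n → f a + d ≤ f (a + d)
increasing-gap {f = f} inc {a} zero _ = ≤-reflexive (trans (+-identityʳ (f a)) (cong f (sym (+-identityʳ a))))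
increasing-gap {f = f} inc {a} (suc d) a+d+1< = begin
  f a + suc d     ≡⟨ +-suc (f a) d ⟩
  suc (f a + d)   ≤⟨ s≤s (increasing-gap inc d a+d<) ⟩
  suc (f (a + d)) ≤⟨ inc a+d<a+d+1 a+d+1< ⟩
  f (a + suc d)   ∎
  where
  open ≤-Reasoning
  a+d<a+d+1 : a + d < a + suc d
  a+d<a+d+1 = +-monoʳ-< a (n<1+n d)
  a+d< : a + d < _
  a+d< = <-trans a+d<a+d+1 a+d+1<

increasing-≥-id : ∀ {n f} → StrictlyIncreasing n f → ∀ {a} → a < n → a ≤ f a
increasing-≥-id {f = f} inc {a} a< = ≤-trans (m≤n+m a (f 0)) (increasing-gap inc {0} a a<)

increasing-room : ∀ {n N f} → StrictlyIncreasing n f → (∀ {a} → a < n → f a < N) →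
                  ∀ {a} d → a < n → a + d ≤ n → f a + d ≤ N
increasing-room {f = f} inc bound {a} zero a< _ = ≤-trans (≤-reflexive (+-identityʳ (f a))) (<⇒≤ (bound a<))
increasing-room {n} {N} {f} inc bound {a} (suc d) _ a+d+1≤ = begin
  f a + suc d     ≡⟨ +-suc (f a) d ⟩
  suc (f a + d)   ≤⟨ s≤s (increasing-gap inc d a+d<) ⟩
  suc (f (a + d)) ≤⟨ bound a+d< ⟩
  N               ∎
  where
  open ≤-Reasoning
  a+d< : a + d < n
  a+d< = subst (_≤ n) (+-suc a d) a+d+1≤

increasing-squeeze : ∀ {n K f} s c N → StrictlyIncreasing n f → (∀ {a} → a < n → f a < K) →
                     n ≡ s + c → K ≡ N + c → N ≤ f s → ∀ {t} → t < c → f (s + t) ≡ N + t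
increasing-squeeze {f = f} s c N inc bound refl refl N≤fs {t} t<c = ≤-antisym upper lower
  where
  open ≤-Reasoning
  st< : s + t < s + c
  st< = +-monoʳ-< s t<c
  t+[c∸t] : t + (c ∸ t) ≡ c
  t+[c∸t] = m+[n∸m]≡n (<⇒≤ t<c)
  s+t+[c∸t] : s + t + (c ∸ t) ≡ s + c
  s+t+[c∸t] = trans (+-assoc s t _) (cong (s +_) t+[c∸t])
  lower : N + t ≤ f (s + t)
  lower = ≤-trans (+-monoˡ-≤ t N≤fs) (increasing-gap inc t st<)
  upper : f (s + t) ≤ N + t
  upper = +-cancelʳ-≤ (c ∸ t) _ _ (begin
    f (s + t) + (c ∸ t) ≤⟨ increasing-room inc bound (c ∸ t) st< (≤-reflexive s+t+[c∸t]) ⟩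
    N + c               ≡⟨ cong (N +_) t+[c∸t] ⟨
    N + (t + (c ∸ t))   ≡⟨ +-assoc N t _ ⟨
    N + t + (c ∸ t)     ∎)

∈⇒∷⊆++ : ∀ {x : ℕ} {xs ys} → x ∈ xs → x ∷ ys ⊆ xs ++ ys
∈⇒∷⊆++ {xs = _ ∷ xs} (here refl) = refl ∷ ++⁺ˡ xs ⊆-refl
∈⇒∷⊆++ {xs = y ∷ _}  (there x∈)  = y ∷ʳ ∈⇒∷⊆++ x∈

record Subsequence (α β : List ℕ) : Set where
  field
    index            : ℕ → ℕ
    index-<          : ∀ {a} → a < length α → index a < length β
    index-increasing : StrictlyIncreasing (length α) index
    index-at         : ∀ {a} → a < length α → at α a ≡ at β (index a)

record Occurrence (α β : List ℕ) : Set where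
  field
    index            : ℕ → ℕ
    index-<          : ∀ {a} → a < length α → index a < length β
    index-increasing : StrictlyIncreasing (length α) index
    index-cmp        : ∀ {a b} → a < length α → b < length α →
                       cmp (at α a) (at α b) ≡ cmp (at β (index a)) (at β (index b))

⊆⇒Subsequence : ∀ {α β} → α ⊆ β → Subsequence α β
⊆⇒Subsequence [] = record { index = λ a → a ; index-< = λ () ; index-increasing = λ _ () ; index-at = λ () }
⊆⇒Subsequence (y ∷ʳ α⊆β) = record
  { index            = λ a → suc (index a)
  ; index-<          = λ a< → s≤s (index-< a<)
  ; index-increasing = λ a<b b< → s≤s (index-increasing a<b b<)
  ; index-at         = index-at
  }
  where open Subsequence (⊆⇒Subsequence α⊆β)
⊆⇒Subsequence {x ∷ α} {x ∷ β} (refl ∷ α⊆β) = record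
  { index = index′ ; index-< = index′-< ; index-increasing = index′-increasing ; index-at = index′-at }
  where
  open Subsequence (⊆⇒Subsequence α⊆β)
  index′ : ℕ → ℕ
  index′ zero    = zero
  index′ (suc a) = suc (index a)
  index′-< : ∀ {a} → a < suc (length α) → index′ a < suc (length β)
  index′-< {zero}  _         = s≤s z≤n
  index′-< {suc a} (s≤s a<) = s≤s (index-< a<)
  index′-increasing : StrictlyIncreasing (suc (length α)) index′
  index′-increasing {zero}  {suc b} _          _         = s≤s z≤n
  index′-increasing {suc a} {suc b} (s≤s a<b) (s≤s b<) = s≤s (index-increasing a<b b<)
  index′-at : ∀ {a} → a < suc (length α) → at (x ∷ α) a ≡ at (x ∷ β) (index′ a)
  index′-at {zero}  _         = refl
  index′-at {suc a} (s≤s a<) = index-at a<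

⪯⇒Occurrence : ∀ {α β} → α ⪯ β → Occurrence α β
⪯⇒Occurrence {α} (τ , τ⊆β , α~τ) with len , same ← sameOrder-toAt {α} {τ} α~τ = record
  { index            = index
  ; index-<          = λ a< → index-< (inτ a<)
  ; index-increasing = λ a<b b< → index-increasing a<b (inτ b<)
  ; index-cmp        = λ a< b< → trans (same a< b<) (cong₂ cmp (index-at (inτ a<)) (index-at (inτ b<)))
  }
  where
  open Subsequence (⊆⇒Subsequence τ⊆β)
  inτ : ∀ {a} → a < length α → a < length τ
  inτ = subst (_ <_) len

occurrence-trans : ∀ {α β γ} → Occurrence α β → Occurrence β γ → Occurrence α γ
occurrence-trans o₁ o₂ = record
  { index            = λ a → O₂.index (O₁.index a)
  ; index-<          = λ a< → O₂.index-< (O₁.index-< a<)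
  ; index-increasing = λ a<b b< → O₂.index-increasing (O₁.index-increasing a<b b<) (O₁.index-< b<)
  ; index-cmp        = λ a< b< → trans (O₁.index-cmp a< b<) (O₂.index-cmp (O₁.index-< a<) (O₁.index-< b<))
  }
  where
  module O₁ = Occurrence o₁
  module O₂ = Occurrence o₂

module _ {α β : List ℕ} (o : Occurrence α β) where
  open Occurrence o

  occurrence-preserves-< : ∀ {a b} → a < length α → b < length α → at α a < at α b → at β (index a) < at β (index b)
  occurrence-preserves-< a< b< αa<αb = cmp≡lt⇒< (trans (sym (index-cmp a< b<)) (<⇒cmp≡lt αa<αb))

  occurrence-reflects-< : ∀ {a b} → a < length α → b < length α → at β (index a) < at β (index b) → at α a < at α b
  occurrence-reflects-< a< b< βa<βb = cmp≡lt⇒< (trans (index-cmp a< b<) (<⇒cmp≡lt βa<βb))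

  occurrence-preserves-≡ : ∀ {a b} → a < length α → b < length α → at α a ≡ at α b → at β (index a) ≡ at β (index b)
  occurrence-preserves-≡ a< b< αa≡αb = cmp≡eq⇒≡ (trans (sym (index-cmp a< b<)) (≡⇒cmp≡eq αa≡αb))

  occurrence-preserves-≤ : ∀ {a b} → a < length α → b < length α → at α a ≤ at α b → at β (index a) ≤ at β (index b)
  occurrence-preserves-≤ a< b< αa≤αb with m≤n⇒m<n∨m≡n αa≤αb
  ... | inj₁ αa<αb = <⇒≤ (occurrence-preserves-< a< b< αa<αb)
  ... | inj₂ αa≡αb = ≤-reflexive (occurrence-preserves-≡ a< b< αa≡αb)

cayley-≤-sameOrder : ∀ {α β n} → length α ≡ n → IsCayleyAt α → SameOrderAt n α β →
                     ∀ v {p} → p < n → at α p ≡ v → v ≤ at β p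
cayley-≤-sameOrder _ _ _ zero _ _ = z≤n
cayley-≤-sameOrder {α} {β} {n} len cay same (suc v) {p} p< αp≡1+v
  with p′ , p′< , αp′≡v ← cay (subst (p <_) (sym len) p<) (subst (v ≤_) (sym αp≡1+v) (n≤1+n v)) =
  ≤-<-trans (cayley-≤-sameOrder {α} {β} len cay same v p′<n αp′≡v) βp′<βp
  where
  p′<n : p′ < n
  p′<n = subst (p′ <_) len p′<
  βp′<βp : at β p′ < at β p
  βp′<βp = cmp≡lt⇒< (trans (sym (same p′<n p<)) (<⇒cmp≡lt (subst₂ _<_ (sym αp′≡v) (sym αp≡1+v) (n<1+n v))))

cayley-sameOrder⇒≡ : ∀ {α β} → length α ≡ length β → IsCayleyAt α → IsCayleyAt β →
                     SameOrderAt (length α) α β → α ≡ β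
cayley-sameOrder⇒≡ {α} {β} len cayα cayβ same = at-ext len λ p< →
  ≤-antisym (cayley-≤-sameOrder {α} {β} refl cayα same _ p< refl)
            (cayley-≤-sameOrder {β} {α} (sym len) cayβ (λ a< b< → sym (same a< b<)) _ p< refl)

sorted-length : ∀ {N xs} → AllPairs _>_ xs → All (_< N) xs → length xs ≤ N
sorted-length []                   []          = z≤n
sorted-length (x>xs ∷ sorted) (x<N ∷ _) = ≤-trans (s≤s (sorted-length sorted x>xs)) x<N

module _ {τ σ : List ℕ} (o : Occurrence τ σ) where
  open Occurrence o

  reflect-sorted : ∀ {bs} → All (_< length τ) bs → AllPairs (_>_ on (at σ ∘ index)) bs → AllPairs (_>_ on at τ) bs
  reflect-sorted []             []              = []
  reflect-sorted (b< ∷ bs<) (b>bs ∷ sorted) =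
    All.zipWith (λ (b′< , b>b′) → occurrence-reflects-< o b′< b< b>b′) (bs< , b>bs) ∷ reflect-sorted bs< sorted

  chain-length-≤ : IsInversionAt τ → ∀ {q bs} → q < length τ → All (_< length τ) bs →
                   AllPairs (_>_ on (at σ ∘ index)) bs → All (λ b → at σ (index b) < at σ (index q)) bs →
                   length bs ≤ q
  chain-length-≤ inversion {q} {bs} q< bs< sorted below = begin
    length bs            ≡⟨ length-map (at τ) bs ⟨
    length (map (at τ) bs) ≤⟨ sorted-length (AllPairs.map⁺ (reflect-sorted bs< sorted)) (All.map⁺ τ-below) ⟩
    at τ q               ≤⟨ inversion q< ⟩
    q                    ∎
    where
    open ≤-Reasoning
    τ-below : All (λ b → at τ b < at τ q) bs
    τ-below = All.zipWith (λ (b< , σb<σq) → occurrence-reflects-< o b< q< σb<σq) (bs< , below)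

indicator : ∀ {X : Set} → Dec X → ℕ
indicator (yes _) = 1
indicator (no _)  = 0

count : ∀ {P : ℕ → Set} → Decidable P → ℕ → ℕ
count P? zero    = 0
count P? (suc n) = count P? n + indicator (P? n)

module _ {P : ℕ → Set} (P? : Decidable P) where

  count-all : ∀ {n} → (∀ {b} → b < n → P b) → count P? n ≡ n
  count-all {zero}  _   = refl
  count-all {suc n} all with P? n
  ... | yes _  = trans (+-comm _ 1) (cong suc (count-all (λ b< → all (m<n⇒m<1+n b<))))
  ... | no ¬Pn = ⊥-elim (¬Pn (all ≤-refl))

  count-none : ∀ {n} → (∀ {b} → b < n → ¬ P b) → count P? n ≡ 0
  count-none {zero}  _    = refl
  count-none {suc n} none with P? n
  ... | yes Pn = ⊥-elim (none ≤-refl Pn)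
  ... | no _   = trans (+-identityʳ _) (count-none (λ b< → none (m<n⇒m<1+n b<)))

  count-witness : ∀ {n} → count P? n ≢ 0 → ∃ λ b → b < n × P b
  count-witness {zero}  c≢0 = ⊥-elim (c≢0 refl)
  count-witness {suc n} c≢0 with P? n
  ... | yes Pn = n , ≤-refl , Pn
  ... | no _ with b , b< , Pb ← count-witness (λ c≡0 → c≢0 (trans (+-identityʳ _) c≡0)) = b , m<n⇒m<1+n b< , Pb

  count-⊎ : ∀ {Q R : ℕ → Set} (Q? : Decidable Q) (R? : Decidable R) {n} →
            (∀ {b} → b < n → P b → Q b ⊎ R b) → count P? n ≤ count Q? n + count R? n
  count-⊎ Q? R? {zero}  _     = z≤n
  count-⊎ {Q} {R} Q? R? {suc n} split = begin
    count P? n + indicator (P? n)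
      ≤⟨ +-mono-≤ (count-⊎ Q? R? (λ b< → split (m<n⇒m<1+n b<))) (indicator-⊎ (split ≤-refl)) ⟩
    (count Q? n + count R? n) + (indicator (Q? n) + indicator (R? n))
      ≡⟨ +-interchange (count Q? n) (count R? n) _ _ ⟩
    (count Q? n + indicator (Q? n)) + (count R? n + indicator (R? n)) ∎
    where
    open ≤-Reasoning
    +-interchange : ∀ a b c d → (a + b) + (c + d) ≡ (a + c) + (b + d)
    +-interchange = solve-∀
    indicator-⊎ : (P n → Q n ⊎ R n) → indicator (P? n) ≤ indicator (Q? n) + indicator (R? n)
    indicator-⊎ split with P? n | Q? n | R? n
    ... | no _   | _     | _     = z≤n
    ... | yes _  | yes _ | _     = s≤s z≤n
    ... | yes _  | no _  | yes _ = s≤s z≤n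
    ... | yes Pn | no ¬Q | no ¬R with split Pn
    ...   | inj₁ Qn = ⊥-elim (¬Q Qn)
    ...   | inj₂ Rn = ⊥-elim (¬R Rn)

count-increasing-≤1 : ∀ {n f} → StrictlyIncreasing n f → ∀ p → count (λ b → f b ≟ p) n ≤ 1
count-increasing-≤1 {zero}      _   p = z≤n
count-increasing-≤1 {suc n} {f} inc p with f n ≟ p
... | yes refl = ≤-reflexive (cong (_+ 1) (count-none (λ b → f b ≟ f n) (λ b< fb≡fn → <-irrefl fb≡fn (inc b< ≤-refl))))
... | no _     = ≤-trans (≤-reflexive (+-identityʳ _)) (count-increasing-≤1 (λ a<b b< → inc a<b (m<n⇒m<1+n b<)) p)

-- Each value below B taken by `val` on [0, A) contributes one entry to the chain and at most two to the count.
module _ (val : ℕ → ℕ) (A : ℕ) (at-most-twice : ∀ w → count (λ b → val b ≟ w) A ≤ 2) where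

  split-count : ∀ w → count (λ b → val b <? suc w) A ≤ count (λ b → val b <? w) A + count (λ b → val b ≟ w) A
  split-count w = count-⊎ (λ b → val b <? suc w) (λ b → val b <? w) (λ b → val b ≟ w) {A} (λ _ → m<1+n⇒m<n∨m≡n)

  value-chain : ∀ B → ∃ λ bs → All (_< A) bs × AllPairs (_>_ on val) bs × All (λ b → val b < B) bs ×
                                count (λ b → val b <? B) A ≤ 2 * length bs
  value-chain zero = [] , [] , [] , [] , ≤-reflexive (count-none (λ b → val b <? 0) {A} (λ _ ()))
  value-chain (suc w) with bs , bs<A , sorted , bs<w , counted ← value-chain w
                      with count (λ b → val b ≟ w) A ≟ 0
  ... | yes none = bs , bs<A , sorted , All.map (λ v< → m<n⇒m<1+n v<) bs<w , (begin
    count (λ b → val b <? suc w) A                               ≤⟨ split-count w ⟩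
    count (λ b → val b <? w) A + count (λ b → val b ≟ w) A       ≡⟨ cong (count (λ b → val b <? w) A +_) none ⟩
    count (λ b → val b <? w) A + 0                               ≡⟨ +-identityʳ _ ⟩
    count (λ b → val b <? w) A                                   ≤⟨ counted ⟩
    2 * length bs                                                ∎)
    where open ≤-Reasoning
  ... | no some with b , b<A , valb≡w ← count-witness (λ b → val b ≟ w) some =
    b ∷ bs , b<A ∷ bs<A , All.map (λ {c} → subst (val c <_) (sym valb≡w)) bs<w ∷ sorted ,
    subst (_< suc w) (sym valb≡w) ≤-refl ∷ All.map (λ v< → m<n⇒m<1+n v<) bs<w , (begin
    count (λ b → val b <? suc w) A                               ≤⟨ split-count w ⟩
    count (λ b → val b <? w) A + count (λ b → val b ≟ w) A       ≤⟨ +-mono-≤ counted (at-most-twice w) ⟩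
    2 * length bs + 2                                            ≡⟨ +-comm (2 * length bs) 2 ⟩
    2 + 2 * length bs                                            ≡⟨ *-suc 2 (length bs) ⟨
    2 * length (b ∷ bs)                                          ∎)
    where open ≤-Reasoning

interval-chain : ∀ (v : ℕ → ℕ) {L} a d → (∀ {w} → a ≤ w → w < a + d → ∃ λ b → b < L × v b ≡ w) →
                 ∃ λ cs → length cs ≡ d × All (_< L) cs × AllPairs (_>_ on v) cs × All (λ b → a ≤ v b × v b < a + d) cs
interval-chain v a zero    _        = [] , refl , [] , [] , []
interval-chain v a (suc d) attained
  with cs , len , cs<L , sorted , inside ← interval-chain v a d (λ a≤w w< → attained a≤w (<-trans w< (+-monoʳ-< a (n<1+n d))))
  with b , b<L , vb≡a+d ← attained (m≤m+n a d) (+-monoʳ-< a (n<1+n d)) =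
  b ∷ cs , cong suc len , b<L ∷ cs<L ,
  All.map (λ {c} (_ , vc<) → subst (v c <_) (sym vb≡a+d) vc<) inside ∷ sorted ,
  (subst (a ≤_) (sym vb≡a+d) (m≤m+n a d) , subst (_< a + suc d) (sym vb≡a+d) a+d<a+d+1) ∷
  All.map (λ (a≤ , vc<) → a≤ , <-trans vc< a+d<a+d+1) inside
  where
  a+d<a+d+1 : a + d < a + suc d
  a+d<a+d+1 = +-monoʳ-< a (n<1+n d)

[i-j]+j≡i : ∀ i j → (i ℤ.- j) ℤ.+ j ≡ i
[i-j]+j≡i = ℤ-Solver.solve-∀

x-y≤m⇒x≤m+y : ∀ {x y m} → ℤ.+ x ℤ.- ℤ.+ y ℤ.≤ ℤ.+ m → x ≤ m + y
x-y≤m⇒x≤m+y {x} {y} {m} x-y≤m =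
  ℤ.drop‿+≤+ (subst₂ ℤ._≤_ ([i-j]+j≡i (ℤ.+ x) (ℤ.+ y)) (sym (ℤ.pos-+ m y)) (ℤ.+-monoˡ-≤ (ℤ.+ y) x-y≤m))

x-y≡m⇒x≡m+y : ∀ {x y m} → ℤ.+ x ℤ.- ℤ.+ y ≡ ℤ.+ m → x ≡ m + y
x-y≡m⇒x≡m+y {x} {y} {m} x-y≡m =
  ℤ.+-injective (trans (sym ([i-j]+j≡i (ℤ.+ x) (ℤ.+ y))) (trans (cong (λ i → i ℤ.+ ℤ.+ y) x-y≡m) (sym (ℤ.pos-+ m y))))

mddFrom-≥ : ∀ j xs {t} → t < length xs → ℤ.+ at xs t ℤ.- ℤ.+ (j + t) ℤ.≤ mddFrom j xs
mddFrom-≥ j (x ∷ [])     {zero}  _ rewrite +-identityʳ j = ℤ.≤-refl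
mddFrom-≥ j (x ∷ [])     {suc t} (s≤s ())
mddFrom-≥ j (x ∷ y ∷ xs) {zero}  _ rewrite +-identityʳ j = ℤ.i≤i⊔j _ _
mddFrom-≥ j (x ∷ y ∷ xs) {suc t} (s≤s t<) rewrite +-suc j t =
  ℤ.≤-trans (mddFrom-≥ (suc j) (y ∷ xs) t<) (ℤ.i≤j⊔i _ _)

mddFrom-attained : ∀ j x xs → ∃ λ t → t < length (x ∷ xs) × ℤ.+ at (x ∷ xs) t ℤ.- ℤ.+ (j + t) ≡ mddFrom j (x ∷ xs)
mddFrom-attained j x []       = 0 , s≤s z≤n , cong (λ i → ℤ.+ x ℤ.- ℤ.+ i) (+-identityʳ j)
mddFrom-attained j x (y ∷ xs) with ℤ.⊔-sel (ℤ.+ x ℤ.- ℤ.+ j) (mddFrom (suc j) (y ∷ xs))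
... | inj₁ max≡head = 0 , s≤s z≤n , trans (cong (λ i → ℤ.+ x ℤ.- ℤ.+ i) (+-identityʳ j)) (sym max≡head)
... | inj₂ max≡tail with t , t< , attained ← mddFrom-attained (suc j) y xs =
  suc t , s≤s t< , trans (cong (λ i → ℤ.+ at (y ∷ xs) t ℤ.- ℤ.+ i) (+-suc j t)) (trans attained (sym max≡tail))

mdd-bound : ∀ {ρ m t} → mdd ρ ≡ ℤ.+ m → t < length ρ → at ρ t ≤ m + t
mdd-bound {ρ} {m} {t} mdd≡m t< = x-y≤m⇒x≤m+y (subst (ℤ.+ at ρ t ℤ.- ℤ.+ t ℤ.≤_) mdd≡m (mddFrom-≥ 0 ρ t<))

mdd-attained : ∀ {x xs m} → mdd (x ∷ xs) ≡ ℤ.+ m → ∃ λ t → t < length (x ∷ xs) × at (x ∷ xs) t ≡ m + t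
mdd-attained {x} {xs} mdd≡m with t , t< , attained ← mddFrom-attained 0 x xs = t , t< , x-y≡m⇒x≡m+y (trans attained mdd≡m)

IsMdd : List ℕ → ℕ → Set
IsMdd ρ m = (∀ {t} → t < length ρ → at ρ t ≤ m + t) × (∃ λ j → j < length ρ × at ρ j ≡ m + j)

mdd⇒IsMdd : ∀ {x xs m} → mdd (x ∷ xs) ≡ ℤ.+ m → IsMdd (x ∷ xs) m
mdd⇒IsMdd mdd≡m = mdd-bound mdd≡m , mdd-attained mdd≡m

-- A criterion for minimality

module Minimality
  {ρ σ : List ℕ} {B c s e : ℕ} (pos₁ pos₂ : ℕ → ℕ)
  (length-σ : length σ ≡ B + B + c)
  (length-ρ : length ρ ≡ s + c)
  (prefix-< : ∀ {p} → p < B + B → at σ p < B)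
  (prefix-twice : ∀ {p} → p < B + B → p ≡ pos₁ (at σ p) ⊎ p ≡ pos₂ (at σ p))
  (cayley-σ : IsCayleyAt σ)
  (e<c : e < c)
  (fixed : at σ (B + B + e) ≡ B + B + e)
  (suffix-forced : ∀ (o : Occurrence ρ σ) → B + B ≤ Occurrence.index o s)
  where

  suffix-position : ∀ {w} → B ≤ w → w ≤ B + B + e → ∃ λ t → t < c × at σ (B + B + t) ≡ w
  suffix-position {w} B≤w w≤
    with p , p< , σp≡w ← cayley-σ (subst (B + B + e <_) (sym length-σ) (+-monoʳ-< (B + B) e<c)) (subst (w ≤_) (sym fixed) w≤)
    with split-position (subst (p <_) length-σ p<)
  ... | inj₁ p<2B             = ⊥-elim (<-irrefl refl (<-≤-trans (subst (_< B) σp≡w (prefix-< p<2B)) B≤w))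
  ... | inj₂ (t , t<c , refl) = t , t<c , σp≡w

  module Between {τ : List ℕ} (inversion-τ : IsInversionAt τ) (ρ-in-τ : Occurrence ρ τ) (τ-in-σ : Occurrence τ σ) where
    open Occurrence ρ-in-τ using () renaming (index to κ; index-< to κ-<; index-increasing to κ-increasing)
    open Occurrence τ-in-σ using (index-cmp) renaming (index to ι; index-< to ι-<; index-increasing to ι-increasing)

    L A : ℕ
    L = length τ
    A = κ s

    image : ℕ → ℕ
    image b = at σ (ι b)

    s<ρ : s < length ρ
    s<ρ = subst (s <_) (sym length-ρ) (m<m+n s (≤-<-trans z≤n e<c))

    ι-A : ι A ≡ B + B
    ι-A = begin
      ι (κ s)       ≡⟨ cong (ι ∘ κ) (+-identityʳ s) ⟨
      ι (κ (s + 0)) ≡⟨ increasing-squeeze s c (B + B) (Occurrence.index-increasing ρ-in-σ) (Occurrence.index-< ρ-in-σ)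
                         length-ρ length-σ (suffix-forced ρ-in-σ) (≤-<-trans z≤n e<c) ⟩
      B + B + 0     ≡⟨ +-identityʳ (B + B) ⟩
      B + B         ∎
      where
      open ≡-Reasoning
      ρ-in-σ = occurrence-trans ρ-in-τ τ-in-σ

    A<L : A < L
    A<L = κ-< s<ρ

    L≡A+c : L ≡ A + c
    L≡A+c = ≤-antisym L≤A+c A+c≤L
      where
      A+c≤L : A + c ≤ L
      A+c≤L = increasing-room κ-increasing κ-< c s<ρ (≤-reflexive (sym length-ρ))
      L∸A≤c : L ∸ A ≤ c
      L∸A≤c = +-cancelˡ-≤ (B + B) _ _ (begin
        B + B + (L ∸ A) ≡⟨ cong (_+ (L ∸ A)) ι-A ⟨
        ι A + (L ∸ A)   ≤⟨ increasing-room ι-increasing ι-< (L ∸ A) A<L (≤-reflexive (m+[n∸m]≡n (<⇒≤ A<L))) ⟩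
        length σ        ≡⟨ length-σ ⟩
        B + B + c       ∎)
        where open ≤-Reasoning
      L≤A+c : L ≤ A + c
      L≤A+c = ≤-trans (m≤n+m∸n L A) (+-monoʳ-≤ A L∸A≤c)

    ι-suffix : ∀ {t} → t < c → ι (A + t) ≡ B + B + t
    ι-suffix = increasing-squeeze A c (B + B) ι-increasing ι-< L≡A+c length-σ (≤-reflexive (sym ι-A))

    ι-prefix : ∀ {b} → b < A → ι b < B + B
    ι-prefix {b} b<A = subst (ι b <_) ι-A (ι-increasing b<A A<L)

    at-most-twice : ∀ w → count (λ b → image b ≟ w) A ≤ 2
    at-most-twice w = begin
      count (λ b → image b ≟ w) A
        ≤⟨ count-⊎ (λ b → image b ≟ w) (λ b → ι b ≟ pos₁ w) (λ b → ι b ≟ pos₂ w) two-positions ⟩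
      count (λ b → ι b ≟ pos₁ w) A + count (λ b → ι b ≟ pos₂ w) A
        ≤⟨ +-mono-≤ (count-increasing-≤1 ι-increasing-on-A (pos₁ w)) (count-increasing-≤1 ι-increasing-on-A (pos₂ w)) ⟩
      2 ∎
      where
      open ≤-Reasoning
      two-positions : ∀ {b} → b < A → image b ≡ w → ι b ≡ pos₁ w ⊎ ι b ≡ pos₂ w
      two-positions {b} b<A refl = prefix-twice (ι-prefix b<A)
      ι-increasing-on-A : StrictlyIncreasing A ι
      ι-increasing-on-A a<b b<A = ι-increasing a<b (<-trans b<A A<L)

    prefix-chain : ∃ λ bs → All (_< A) bs × AllPairs (_>_ on image) bs × All (λ b → image b < B) bs × A ≤ 2 * length bs
    prefix-chain with bs , bs<A , sorted , bs<B , counted ← value-chain image A at-most-twice B =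
      bs , bs<A , sorted , bs<B ,
      subst (_≤ 2 * length bs) (count-all (λ b → image b <? B) (λ b<A → prefix-< (ι-prefix b<A))) counted

    suffix-chain : ∃ λ cs → length cs ≡ B + e × All (_< L) cs × AllPairs (_>_ on image) cs ×
                            All (λ b → B ≤ image b × image b < B + (B + e)) cs
    suffix-chain = interval-chain image B (B + e) λ {w} B≤w w< →
      let t , t<c , σ≡w = suffix-position B≤w (<⇒≤ (subst (w <_) (sym (+-assoc B B e)) w<))
      in A + t , subst (A + t <_) (sym L≡A+c) (+-monoʳ-< A t<c) , trans (cong (at σ) (ι-suffix t<c)) σ≡w

    2B≤A : B + B ≤ A
    2B≤A with bs , bs<A , bs-sorted , bs<B , A≤2|bs| ← prefix-chain
         with cs , |cs| , cs<L , cs-sorted , cs-inside ← suffix-chain =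
      ≤-trans (+-monoʳ-≤ B B≤|bs|) B+|bs|≤A
      where
      q = A + e
      image-q : image q ≡ B + B + e
      image-q = trans (cong (at σ) (ι-suffix e<c)) fixed
      chain-bound : length (cs ++ bs) ≤ q
      chain-bound = chain-length-≤ τ-in-σ inversion-τ q< (All.++⁺ cs<L (All.map (λ b<A → <-trans b<A A<L) bs<A))
        (AllPairs.++⁺ cs-sorted bs-sorted (All.map (λ (B≤ , _) → All.map (λ b< → <-≤-trans b< B≤) bs<B) cs-inside))
        (All.++⁺ (All.map (λ {c} (_ , c<) → subst (image c <_) (trans (sym (+-assoc B B e)) (sym image-q)) c<) cs-inside)
                 (All.map (λ {b} b<B → subst (image b <_) (sym image-q) (≤-trans b<B B≤Y)) bs<B))
        where
        q< = subst (q <_) (sym L≡A+c) (+-monoʳ-< A e<c)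
        B≤Y = ≤-trans (m≤m+n B B) (m≤m+n (B + B) e)
      B+|bs|≤A : B + length bs ≤ A
      B+|bs|≤A = +-cancelʳ-≤ e _ _ (begin
        B + length bs + e     ≡⟨ rearrange B (length bs) e ⟩
        (B + e) + length bs   ≡⟨ cong (_+ length bs) |cs| ⟨
        length cs + length bs ≡⟨ length-++ cs ⟨
        length (cs ++ bs)     ≤⟨ chain-bound ⟩
        A + e                 ∎)
        where
        open ≤-Reasoning
        rearrange : ∀ a b c → a + b + c ≡ (a + c) + b
        rearrange = solve-∀
      B≤|bs| : B ≤ length bs
      B≤|bs| = +-cancelʳ-≤ (length bs) _ _
        (≤-trans B+|bs|≤A (≤-trans A≤2|bs| (≤-reflexive (cong (length bs +_) (+-identityʳ (length bs))))))

    A≤2B : A ≤ B + B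
    A≤2B = subst (A ≤_) ι-A (increasing-≥-id ι-increasing A<L)

    L≡|σ| : L ≡ length σ
    L≡|σ| = trans L≡A+c (trans (cong (_+ c) (≤-antisym A≤2B 2B≤A)) (sym length-σ))

    ι-identity : ∀ {a} → a < L → ι a ≡ a
    ι-identity = increasing-squeeze 0 L 0 ι-increasing ι-< refl (sym L≡|σ|) z≤n

    same-order : SameOrderAt L τ σ
    same-order a< b< = trans (index-cmp a< b<) (cong₂ cmp (cong (at σ) (ι-identity a<)) (cong (at σ) (ι-identity b<)))

  minimal : ∀ τ → InIP ρ τ → τ ⪯ σ → τ ≡ σ
  minimal τ (inversion-τ , cayley-τ , ρ⪯τ) τ⪯σ = cayley-sameOrder⇒≡ L≡|σ| (cayley-toAt cayley-τ) cayley-σ same-order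
    where open Between (inversion-toAt {τ} inversion-τ) (⪯⇒Occurrence ρ⪯τ) (⪯⇒Occurrence τ⪯σ)

-- A doubled prefix followed by a lifted copy of ρ′

module DoubledPrefix
  (B m : ℕ) (pv : ℕ → ℕ) (suffix : List ℕ) (pos₁ pos₂ : ℕ → ℕ)
  (pv-< : ∀ {p} → p < B + B → pv p < B)
  (pv-≤ : ∀ {p} → p < B + B → pv p ≤ p)
  (pv-onto : ∀ {v} → v < B → ∃ λ p → p < B + B × pv p ≡ v)
  (pv-twice : ∀ {p} → p < B + B → p ≡ pos₁ (pv p) ⊎ p ≡ pos₂ (pv p))
  (suffix-≤ : ∀ {t} → t < length suffix → at suffix t + m ≤ B + B + t)
  (suffix-cayley : ∀ {v t} → t < length suffix → B ≤ v → v ≤ at suffix t + m →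
                   ∃ λ t′ → t′ < length suffix × at suffix t′ + m ≡ v)
  where

  c : ℕ
  c = length suffix

  prefix : List ℕ
  prefix = applyUpTo pv (B + B)

  σ : List ℕ
  σ = prefix ++ map (_+ m) suffix

  length-σ : length σ ≡ B + B + c
  length-σ = trans (length-++ prefix) (cong₂ _+_ (length-applyUpTo pv (B + B)) (length-map (_+ m) suffix))

  at-prefix : ∀ {p} → p < B + B → at σ p ≡ pv p
  at-prefix p< = trans (at-++ˡ {prefix} _ (subst (_ <_) (sym (length-applyUpTo pv (B + B))) p<)) (at-applyUpTo pv p<)

  at-suffix : ∀ {t} → t < c → at σ (B + B + t) ≡ at suffix t + m
  at-suffix {t} t< = begin
    at σ (B + B + t)           ≡⟨ cong (λ n → at σ (n + t)) (length-applyUpTo pv (B + B)) ⟨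
    at σ (length prefix + t)   ≡⟨ at-++ʳ prefix t ⟩
    at (map (_+ m) suffix) t   ≡⟨ at-map (_+ m) {suffix} t< ⟩
    at suffix t + m            ∎
    where open ≡-Reasoning

  inversion-σ : IsInversionAt σ
  inversion-σ p< with split-position (subst (_ <_) length-σ p<)
  ... | inj₁ p<2B             = subst (_≤ _) (sym (at-prefix p<2B)) (pv-≤ p<2B)
  ... | inj₂ (t , t<c , refl) = subst (_≤ _) (sym (at-suffix t<c)) (suffix-≤ t<c)

  cayley-σ : IsCayleyAt σ
  cayley-σ {v} {p} p< v≤ with v <? B
  ... | yes v<B with p′ , p′<2B , pv≡v ← pv-onto v<B =
    p′ , subst (p′ <_) (sym length-σ) (<-≤-trans p′<2B (m≤m+n (B + B) c)) , trans (at-prefix p′<2B) pv≡v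
  ... | no v≮B with split-position (subst (_ <_) length-σ p<)
  ...   | inj₁ p<2B = ⊥-elim (v≮B (≤-<-trans v≤ (subst (_< B) (sym (at-prefix p<2B)) (pv-< p<2B))))
  ...   | inj₂ (t , t<c , refl)
    with t′ , t′<c , attained ← suffix-cayley t<c (≮⇒≥ v≮B) (subst (v ≤_) (at-suffix t<c) v≤) =
    B + B + t′ , subst (B + B + t′ <_) (sym length-σ) (+-monoʳ-< (B + B) t′<c) , trans (at-suffix t′<c) attained

  isMinimal : ∀ {ρ s e} → length ρ ≡ s + c → ρ ⪯ σ → e < c → at suffix e + m ≡ B + B + e →
              (∀ (o : Occurrence ρ σ) → B + B ≤ Occurrence.index o s) → IsMinimal ρ σ
  isMinimal length-ρ ρ⪯σ e<c fixed suffix-forced =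
    (inversion-fromAt {σ} inversion-σ , cayley-fromAt {σ} cayley-σ , ρ⪯σ) ,
    Minimality.minimal pos₁ pos₂ length-σ length-ρ prefix-< prefix-twice cayley-σ e<c (trans (at-suffix e<c) fixed) suffix-forced
    where
    prefix-< : ∀ {p} → p < B + B → at σ p < B
    prefix-< p< = subst (_< B) (sym (at-prefix p<)) (pv-< p<)
    prefix-twice : ∀ {p} → p < B + B → p ≡ pos₁ (at σ p) ⊎ p ≡ pos₂ (at σ p)
    prefix-twice {p} p< = subst (λ v → p ≡ pos₁ v ⊎ p ≡ pos₂ v) (sym (at-prefix p<)) (pv-twice p<)

-- First case: a zero of ρ after position 0 other than a second leading zero

⌊n/2⌋<m : ∀ {m n} → n < m + m → ⌊ n /2⌋ < m
⌊n/2⌋<m {suc m} {zero}        _          = s≤s z≤n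
⌊n/2⌋<m {suc m} {suc zero}    _          = s≤s z≤n
⌊n/2⌋<m {suc m} {suc (suc n)} (s≤s n+1<) = s≤s (⌊n/2⌋<m {m} (≤-pred (subst (suc (suc n) ≤_) (+-suc m m) n+1<)))

⌊n/2⌋-parity : ∀ n → n ≡ ⌊ n /2⌋ + ⌊ n /2⌋ ⊎ n ≡ suc (⌊ n /2⌋ + ⌊ n /2⌋)
⌊n/2⌋-parity zero          = inj₁ refl
⌊n/2⌋-parity (suc zero)    = inj₂ refl
⌊n/2⌋-parity (suc (suc n)) with ⌊n/2⌋-parity n
... | inj₁ even = inj₁ (cong suc (trans (cong suc even) (sym (+-suc ⌊ n /2⌋ ⌊ n /2⌋))))
... | inj₂ odd  = inj₂ (cong (suc ∘ suc) (trans odd (sym (+-suc ⌊ n /2⌋ ⌊ n /2⌋))))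

LateZero : List ℕ → Set
LateZero ρ = ∃ λ i → 1 ≤ i × i < length ρ × at ρ i ≡ 0 × (at ρ 0 ≡ 0 → 2 ≤ i)

module LateZeroCase {ρ : List ℕ} {m : ℕ} (cayley-ρ : IsCayleyAt ρ) (is-mdd : IsMdd ρ m) (late : m ≡ 0 ⊎ LateZero ρ) where

  m+t+m≡m+m+t : ∀ t → m + t + m ≡ m + m + t
  m+t+m≡m+m+t t = trans (+-assoc m t m) (trans (cong (m +_) (+-comm t m)) (sym (+-assoc m m t)))

  suffix-≤ : ∀ {t} → t < length ρ → at ρ t + m ≤ m + m + t
  suffix-≤ {t} t< = ≤-trans (+-monoˡ-≤ m (proj₁ is-mdd t<)) (≤-reflexive (m+t+m≡m+m+t t))

  suffix-cayley : ∀ {v t} → t < length ρ → m ≤ v → v ≤ at ρ t + m →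
                  ∃ λ t′ → t′ < length ρ × at ρ t′ + m ≡ v
  suffix-cayley {v} {t} t< m≤v v≤
    with t′ , t′< , ρt′≡v∸m ← cayley-ρ t< (subst (v ∸ m ≤_) (m+n∸n≡m (at ρ t) m) (∸-monoˡ-≤ m v≤)) =
    t′ , t′< , trans (cong (_+ m) ρt′≡v∸m) (m∸n+n≡m m≤v)

  open DoubledPrefix m m ⌊_/2⌋ ρ (λ w → w + w) (λ w → suc (w + w))
    ⌊n/2⌋<m (λ {p} _ → ⌊n/2⌋≤n p) (λ {v} v<m → v + v , +-mono-< v<m v<m , sym (n≡⌊n+n/2⌋ v))
    (λ {p} _ → ⌊n/2⌋-parity p)
    suffix-≤ suffix-cayley

  ρ⪯σ : ρ ⪯ σ
  ρ⪯σ = map (_+ m) ρ , ++⁺ˡ prefix ⊆-refl ,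
        sameOrder-image {ρ} {map (_+ m) ρ} (+-monoˡ-< m) (sym (length-map (_+ m) ρ)) (at-map (_+ m) {ρ})

  small⇒prefix : ∀ {p} → p < length σ → at σ p < m → p < m + m
  small⇒prefix p< σp<m with split-position (subst (_ <_) length-σ p<)
  ... | inj₁ p<2m             = p<2m
  ... | inj₂ (t , t<c , refl) = ⊥-elim (<⇒≱ σp<m (subst (m ≤_) (sym (at-suffix t<c)) (m≤n+m m (at ρ t))))

  late-zero-blocks-prefix : ∀ (o : Occurrence ρ σ) → LateZero ρ → Occurrence.index o 0 < m + m → ⊥
  late-zero-blocks-prefix o (i , 1≤i , i< , ρi≡0 , ρ0≡0⇒2≤i) f0<2m = by-head (at ρ 0 ≟ 0)
    where
    open Occurrence o renaming (index to f)
    0<ρ : 0 < length ρ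
    0<ρ = ≤-<-trans z≤n i<
    σfi≤σf0 : at σ (f i) ≤ at σ (f 0)
    σfi≤σf0 = occurrence-preserves-≤ o i< 0<ρ (subst (_≤ at ρ 0) (sym ρi≡0) z≤n)
    fi<2m : f i < m + m
    fi<2m = small⇒prefix (index-< i<) (≤-<-trans σfi≤σf0 (subst (_< m) (sym (at-prefix f0<2m)) (⌊n/2⌋<m f0<2m)))
    ⌊fi/2⌋≤⌊f0/2⌋ : ⌊ f i /2⌋ ≤ ⌊ f 0 /2⌋
    ⌊fi/2⌋≤⌊f0/2⌋ = subst₂ _≤_ (at-prefix fi<2m) (at-prefix f0<2m) σfi≤σf0
    by-head : Dec (at ρ 0 ≡ 0) → ⊥
    by-head (yes ρ0≡0) = <⇒≱ (⌊n/2⌋-mono 2+f0≤fi) ⌊fi/2⌋≤⌊f0/2⌋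
      where
      2+f0≤fi : 2 + f 0 ≤ f i
      2+f0≤fi = begin
        2 + f 0 ≡⟨ +-comm 2 (f 0) ⟩
        f 0 + 2 ≤⟨ +-monoʳ-≤ (f 0) (ρ0≡0⇒2≤i ρ0≡0) ⟩
        f 0 + i ≤⟨ increasing-gap index-increasing i i< ⟩
        f i     ∎
        where open ≤-Reasoning
    by-head (no ρ0≢0) =
      <⇒≱ (subst₂ _<_ (at-prefix fi<2m) (at-prefix f0<2m) σfi<σf0) (⌊n/2⌋-mono (<⇒≤ (index-increasing 1≤i i<)))
      where
      σfi<σf0 : at σ (f i) < at σ (f 0)
      σfi<σf0 = occurrence-preserves-< o i< 0<ρ (subst (_< at ρ 0) (sym ρi≡0) (n≢0⇒n>0 ρ0≢0))

  suffix-forced : ∀ (o : Occurrence ρ σ) → m + m ≤ Occurrence.index o 0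
  suffix-forced o with m + m ≤? Occurrence.index o 0
  ... | yes 2m≤f0 = 2m≤f0
  ... | no 2m≰f0 = ⊥-elim ([ (λ m≡0 → 2m≰f0 (subst (λ n → n + n ≤ _) (sym m≡0) z≤n))
                            , (λ lateρ → late-zero-blocks-prefix o lateρ (≰⇒> 2m≰f0)) ]′ late)

  result : ∃ λ σ′ → length σ′ ≡ length ρ + 2 * m × IsMinimal ρ σ′
  result with j , j< , tight ← proj₂ is-mdd =
    σ , trans length-σ (rearrange m (length ρ)) ,
    isMinimal refl ρ⪯σ j< (trans (cong (_+ m) tight) (m+t+m≡m+m+t j)) suffix-forced
    where
    rearrange : ∀ m k → m + m + k ≡ k + 2 * m
    rearrange = solve-∀

-- Second case: ρ = 0 0 ρ₂ with ρ₂ positive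

tent : ℕ → ℕ → ℕ
tent B p with p <? B
... | yes _ = p
... | no _  = B + B ∸ suc p

module _ (B : ℕ) where

  tent-low : ∀ {p} → p < B → tent B p ≡ p
  tent-low {p} p<B with p <? B
  ... | yes _   = refl
  ... | no p≮B = ⊥-elim (p≮B p<B)

  tent-high : ∀ {p} → B ≤ p → tent B p ≡ B + B ∸ suc p
  tent-high {p} B≤p with p <? B
  ... | yes p<B = ⊥-elim (<⇒≱ p<B B≤p)
  ... | no _    = refl

  tent-< : ∀ {p} → p < B + B → tent B p < B
  tent-< {p} p<2B with p <? B
  ... | yes p<B = p<B
  ... | no p≮B = subst (B + B ∸ suc p <_) (m+n∸m≡n B B) (∸-monoʳ-< (s≤s (≮⇒≥ p≮B)) p<2B)

  tent-≤ : ∀ {p} → tent B p ≤ p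
  tent-≤ {p} with p <? B
  ... | yes _   = ≤-refl
  ... | no p≮B = begin
    B + B ∸ suc p ≤⟨ ∸-monoʳ-≤ (B + B) (m≤n⇒m≤1+n (≮⇒≥ p≮B)) ⟩
    B + B ∸ B     ≡⟨ m+n∸m≡n B B ⟩
    B             ≤⟨ ≮⇒≥ p≮B ⟩
    p             ∎
    where open ≤-Reasoning

  tent-twice : ∀ {p} → p < B + B → p ≡ tent B p ⊎ p ≡ B + B ∸ suc (tent B p)
  tent-twice {p} p<2B with p <? B
  ... | yes _ = inj₁ refl
  ... | no _  = inj₂ (trans (sym (m∸[m∸n]≡n (<⇒≤ p<2B))) (cong (B + B ∸_) (+-∸-assoc 1 p<2B)))

  tent-nested : ∀ {p q r} → p < q → q < r → r < B + B → tent B p ≡ tent B q → tent B r < tent B q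
  tent-nested {p} {q} {r} p<q q<r r<2B same = by-position (q <? B)
    where
    by-position : Dec (q < B) → tent B r < tent B q
    by-position (yes q<B) = ⊥-elim (<⇒≢ p<q (trans (sym (tent-low (<-trans p<q q<B))) (trans same (tent-low q<B))))
    by-position (no q≮B)  = begin-strict
      tent B r      ≡⟨ tent-high (≤-trans (≮⇒≥ q≮B) (<⇒≤ q<r)) ⟩
      B + B ∸ suc r <⟨ ∸-monoʳ-< (s≤s q<r) r<2B ⟩
      B + B ∸ suc q ≡⟨ tent-high (≮⇒≥ q≮B) ⟨
      tent B q      ∎
      where open ≤-Reasoning

tent-last : ∀ m → tent (suc m) (suc (m + m)) ≡ 0
tent-last m = trans (tent-high (suc m) (s≤s (m≤m+n m m))) (trans (cong (_∸ suc (m + m)) (+-suc m m)) (n∸n≡0 (suc (m + m))))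

module DoubleZeroCase {ρ₂ : List ℕ} {m : ℕ} (cayley-ρ : IsCayleyAt (0 ∷ 0 ∷ ρ₂)) (is-mdd : IsMdd (0 ∷ 0 ∷ ρ₂) m)
  (1≤m : 1 ≤ m) (positive : ∀ {t} → t < length ρ₂ → 0 < at ρ₂ t) where

  ρ : List ℕ
  ρ = 0 ∷ 0 ∷ ρ₂

  B : ℕ
  B = suc m

  m+[2+t]+m≡B+B+t : ∀ t → m + (2 + t) + m ≡ B + B + t
  m+[2+t]+m≡B+B+t t = rearrange m t
    where
    rearrange : ∀ m t → m + (2 + t) + m ≡ suc m + suc m + t
    rearrange = solve-∀

  suffix-≤ : ∀ {t} → t < length ρ₂ → at ρ₂ t + m ≤ B + B + t
  suffix-≤ {t} t< = ≤-trans (+-monoˡ-≤ m (proj₁ is-mdd (s≤s (s≤s t<)))) (≤-reflexive (m+[2+t]+m≡B+B+t t))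

  suffix-cayley : ∀ {v t} → t < length ρ₂ → B ≤ v → v ≤ at ρ₂ t + m →
                  ∃ λ t′ → t′ < length ρ₂ × at ρ₂ t′ + m ≡ v
  suffix-cayley {v} {t} t< B≤v v≤ =
    in-suffix (cayley-ρ (s≤s (s≤s t<)) (subst (v ∸ m ≤_) (m+n∸n≡m (at ρ₂ t) m) (∸-monoˡ-≤ m v≤)))
    where
    0<v∸m : 0 < v ∸ m
    0<v∸m = subst (_≤ v ∸ m) (m+n∸n≡m 1 m) (∸-monoˡ-≤ m B≤v)
    in-suffix : (∃ λ t″ → t″ < length ρ × at ρ t″ ≡ v ∸ m) →
                ∃ λ t′ → t′ < length ρ₂ × at ρ₂ t′ + m ≡ v
    in-suffix (zero         , _               , 0≡v∸m)   = ⊥-elim (<⇒≢ 0<v∸m 0≡v∸m)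
    in-suffix (suc zero     , _               , 0≡v∸m)   = ⊥-elim (<⇒≢ 0<v∸m 0≡v∸m)
    in-suffix (suc (suc t′) , s≤s (s≤s t′<) , ρ₂t′≡v∸m) =
      t′ , t′< , trans (cong (_+ m) ρ₂t′≡v∸m) (m∸n+n≡m (<⇒≤ B≤v))

  open DoubledPrefix B m (tent B) ρ₂ (λ w → w) (λ w → B + B ∸ suc w)
    (tent-< B) (λ _ → tent-≤ B) (λ v<B → _ , <-≤-trans v<B (m≤m+n B B) , tent-low B v<B) (tent-twice B)
    suffix-≤ suffix-cayley

  shift-nonzero : ℕ → ℕ
  shift-nonzero zero    = zero
  shift-nonzero (suc x) = suc x + m

  shift-nonzero-increasing : ∀ {x y} → x < y → shift-nonzero x < shift-nonzero y
  shift-nonzero-increasing {zero}  {suc y} _   = s≤s z≤n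
  shift-nonzero-increasing {suc x} {suc y} x<y = +-monoˡ-< m x<y

  ρ⪯σ : ρ ⪯ σ
  ρ⪯σ = τ , sym (tent-low B (s≤s z≤n)) ∷ ∈⇒∷⊆++ 0∈prefix ,
        sameOrder-image {ρ} {τ} shift-nonzero-increasing (cong (suc ∘ suc) (sym (length-map (_+ m) ρ₂))) image
    where
    τ : List ℕ
    τ = 0 ∷ 0 ∷ map (_+ m) ρ₂
    0∈prefix : 0 ∈ applyUpTo (tent B ∘ suc) (m + suc m)
    0∈prefix = subst (_∈ applyUpTo (tent B ∘ suc) (m + suc m)) (tent-last m)
                     (∈-applyUpTo⁺ (tent B ∘ suc) (+-monoʳ-< m (n<1+n m)))
    image : ∀ {a} → a < length ρ → at τ a ≡ shift-nonzero (at ρ a)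
    image {zero}        _               = refl
    image {suc zero}    _               = refl
    image {suc (suc t)} (s≤s (s≤s t<)) with at ρ₂ t | at-map (_+ m) {ρ₂} t< | positive t<
    ... | suc x | τt≡x+m | _ = τt≡x+m

  tight-in-suffix : ∃ λ e → e < length ρ₂ × at ρ₂ e ≡ m + (2 + e)
  tight-in-suffix with proj₂ is-mdd
  ... | zero          , _               , 0≡m+0 = ⊥-elim (<⇒≢ (≤-trans 1≤m (m≤m+n m 0)) 0≡m+0)
  ... | suc zero      , _               , 0≡m+1 = ⊥-elim (<⇒≢ (≤-trans 1≤m (m≤m+n m 1)) 0≡m+1)
  ... | suc (suc e)   , s≤s (s≤s e<) , tight  = e , e< , tight

  suffix-forced : ∀ (o : Occurrence ρ σ) → B + B ≤ Occurrence.index o 2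
  suffix-forced o with B + B ≤? Occurrence.index o 2
  ... | yes 2B≤f2 = 2B≤f2
  ... | no 2B≰f2  = ⊥-elim (<-asym (tent-nested B f0<f1 f1<f2 f2<2B tent-f0≡tent-f1) tent-f1<tent-f2)
    where
    open Occurrence o renaming (index to f)
    0<ρ₂ : 0 < length ρ₂
    0<ρ₂ = ≤-<-trans z≤n (proj₁ (proj₂ tight-in-suffix))
    2<ρ : 2 < length ρ
    2<ρ = s≤s (s≤s 0<ρ₂)
    1<ρ : 1 < length ρ
    1<ρ = <-trans (n<1+n 1) 2<ρ
    f0<f1 : f 0 < f 1
    f0<f1 = index-increasing (n<1+n 0) 1<ρ
    f1<f2 : f 1 < f 2
    f1<f2 = index-increasing (n<1+n 1) 2<ρ
    f2<2B : f 2 < B + B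
    f2<2B = ≰⇒> 2B≰f2
    f1<2B = <-trans f1<f2 f2<2B
    f0<2B = <-trans f0<f1 f1<2B
    tent-f0≡tent-f1 : tent B (f 0) ≡ tent B (f 1)
    tent-f0≡tent-f1 = subst₂ _≡_ (at-prefix f0<2B) (at-prefix f1<2B) (occurrence-preserves-≡ o (s≤s z≤n) 1<ρ refl)
    tent-f1<tent-f2 : tent B (f 1) < tent B (f 2)
    tent-f1<tent-f2 = subst₂ _<_ (at-prefix f1<2B) (at-prefix f2<2B) (occurrence-preserves-< o 1<ρ 2<ρ (positive 0<ρ₂))

  result : ∃ λ σ′ → length σ′ ≡ length ρ + 2 * m × IsMinimal ρ σ′
  result with e , e< , tight ← tight-in-suffix =
    σ , trans length-σ (rearrange m (length ρ₂)) ,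
    isMinimal {ρ} {2} refl ρ⪯σ e< (trans (cong (_+ m) tight) (m+[2+t]+m≡B+B+t e)) suffix-forced
    where
    rearrange : ∀ m c → suc m + suc m + c ≡ 2 + c + 2 * m
    rearrange = solve-∀

late-zero-or-double-zero : ∀ {ρ} → (∃ λ i → 1 ≤ i × i < length ρ × at ρ i ≡ 0) →
  LateZero ρ ⊎ ∃ λ ρ₂ → ρ ≡ 0 ∷ 0 ∷ ρ₂ × (∀ {t} → t < length ρ₂ → 0 < at ρ₂ t)
late-zero-or-double-zero {[]}         (_     , _ , ()       , _)
late-zero-or-double-zero {_ ∷ []}     (suc _ , _ , s≤s () , _)
late-zero-or-double-zero {x ∷ y ∷ ρ₂} (i , 1≤i , i< , ρi≡0) with x ≟ 0 | 0 ∈? ρ₂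
... | no x≢0  | _       = inj₁ (i , 1≤i , i< , ρi≡0 , λ x≡0 → ⊥-elim (x≢0 x≡0))
... | yes x≡0 | yes 0∈ρ₂ with t , t< , ρ₂t≡0 ← ∈⇒at 0∈ρ₂ =
  inj₁ (2 + t , s≤s z≤n , s≤s (s≤s t<) , ρ₂t≡0 , λ _ → s≤s (s≤s z≤n))
... | yes x≡0 | no 0∉ρ₂ = inj₂ (ρ₂ , cong₂ (λ x y → x ∷ y ∷ ρ₂) x≡0 (y≡0 i 1≤i i< ρi≡0) ,
                                 λ t< → n≢0⇒n>0 (λ ρ₂t≡0 → 0∉ρ₂ (subst (_∈ ρ₂) ρ₂t≡0 (at-∈ t<))))
  where
  y≡0 : ∀ i → 1 ≤ i → i < length (x ∷ y ∷ ρ₂) → at (x ∷ y ∷ ρ₂) i ≡ 0 → y ≡ 0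
  y≡0 (suc zero)    _ _               ρ1≡0  = ρ1≡0
  y≡0 (suc (suc t)) _ (s≤s (s≤s t<)) ρ₂t≡0 = ⊥-elim (0∉ρ₂ (subst (_∈ ρ₂) ρ₂t≡0 (at-∈ t<)))

open import Data.Integer using (+_)

proposition4p1 : (k : ℕ) → 2 ≤ k → (ρ : List ℕ) → length ρ ≡ k → IsCayley ρ →
    (m : ℕ) → mdd ρ ≡ + m →
    (∃ λ (i : Fin (length ρ)) → 1 ≤ toℕ i × lookup ρ i ≡ 0) →
    ∃ λ (σ : List ℕ) → length σ ≡ k + 2 * m × IsMinimal ρ σ
proposition4p1 _ _ [] _ _ _ _ (() , _)
proposition4p1 _ _ ρ@(_ ∷ _) refl cayley m mdd≡m (i , 1≤i , ρi≡0)
  with m ≟ 0 | late-zero-or-double-zero (toℕ i , 1≤i , toℕ<n i , trans (sym (lookup≡at ρ i)) ρi≡0)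
... | yes m≡0 | _         = LateZeroCase.result (cayley-toAt cayley) (mdd⇒IsMdd mdd≡m) (inj₁ m≡0)
... | no _    | inj₁ late = LateZeroCase.result (cayley-toAt cayley) (mdd⇒IsMdd mdd≡m) (inj₂ late)
... | no m≢0  | inj₂ (ρ₂ , refl , positive) =
  DoubleZeroCase.result (cayley-toAt cayley) (mdd⇒IsMdd mdd≡m) (n≢0⇒n>0 m≢0) positive
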